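{- For every $k\ge1$, $\mathcal{R}_{U_k}(W_{1.5})\subseteq\mathcal{R}(W_{1.5})$.
   Context: The 1.5-way tape $W_{1.5}$ has cells $0,1,2,\dots$, initial cell $0$, and from each cell $n$ an edge $n\to n+1$ marked $+$ and an edge $n\to 0$ marked $-$. An $h$-head automaton with auxiliary memory of model $M$ (here $W_{1.5}$) has a finite state set, input alphabet $\Sigma$ with endmarkers $\triangleleft,\triangleright$, a finite memory alphabet $\Delta$, a transition function mapping (state, the $h$ symbols under its 2-way read-only input heads, the symbol in the current memory cell) to (new state, a move in $\{ -1,0,+1\}$ per head, and $+$, $-$ or "stay" for the memory position), an initial state and accepting states; it starts with heads at the leftmost input symbol and memory at cell $0$, and runs deterministically for a fixed memory content $\mu\colon M\to\Delta$. It accepts $w$ iff for some $\mu$ it reaches an accepting state; $\mathcal{R}(M)$ is the class of languages so recognized. For a set $\mathcal{T}\subseteq\Delta^M$ of memory contents, the automaton accepts $w$ with a $\mathcal{T}$-restricted guess iff it reaches an accepting state on some $\mu\in\mathcal{T}$; $\mathcal{R}_{\mathcal{T}}(M)$ is the class of languages $L$ for which some such automaton accepts with a $\mathcal T$-restricted guess exactly the words of $L$. For a memory alphabet $\Delta=\{0\}\cup\Delta'$, the set $U_k$ of $k$-sparse guesses consists of memory contents having at most $k$ cells with symbols from $\Delta'$. -}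

module Defs where

open import Data.Nat using (ℕ; zero; suc; _≤_)
open import Data.Fin using (Fin; zero; suc)
open import Data.List using (List; []; _∷_; length)
open import Data.List.Membership.Propositional using (_∈_)
open import Data.Vec using (Vec; []; _∷_; replicate)
open import Data.Maybe using (Maybe; just; nothing; _>>=_)
open import Data.Product using (Σ; ∃; _×_; _,_)
open import Data.Bool using (Bool; true)
open import Function.Bundles using (_⇔_)
open import Relation.Binary.PropositionalEquality using (_≡_; _≢_)

data TapeSym (A : Set) : Set where
  ◁ ▷ : TapeSym A
  sym : A → TapeSym A

data HeadMove : Set where
  left stay right : HeadMove

data MemMove : Set where
  plus minus mstay : MemMove

moveMem : MemMove → ℕ → ℕ
moveMem plus  n = suc n
moveMem minus n = zero
moveMem mstay n = n

record Automaton (Σ' : Set) (Δ : Set) : Set where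
  field
    heads     : ℕ
    nstates   : ℕ
    δ         : Fin nstates → Vec (TapeSym Σ') heads → Δ →
                Fin nstates × Vec HeadMove heads × MemMove
    q₀        : Fin nstates
    accepting : Fin nstates → Bool

-- The input tape for w is ◁ w ▷, positions 0 .. |w|+1.
readBody : {A : Set} → List A → ℕ → Maybe (TapeSym A)
readBody []      zero    = just ▷
readBody []      (suc _) = nothing
readBody (a ∷ w) zero    = just (sym a)
readBody (a ∷ w) (suc i) = readBody w i

readTape : {A : Set} → List A → ℕ → Maybe (TapeSym A)
readTape w zero    = just ◁
readTape w (suc i) = readBody w i

readAll : {A : Set} {h : ℕ} → List A → Vec ℕ h → Maybe (Vec (TapeSym A) h)
readAll w []       = just []
readAll w (p ∷ ps) = readTape w p >>= λ a → readAll w ps >>= λ as → just (a ∷ as)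

moveHead : HeadMove → ℕ → Maybe ℕ
moveHead left  zero    = nothing
moveHead left  (suc n) = just n
moveHead stay  n       = just n
moveHead right n       = just (suc n)

moveAll : {h : ℕ} → Vec HeadMove h → Vec ℕ h → Maybe (Vec ℕ h)
moveAll []       []       = just []
moveAll (m ∷ ms) (p ∷ ps) = moveHead m p >>= λ p' → moveAll ms ps >>= λ ps' → just (p' ∷ ps')

module _ {Σ' Δ : Set} (A : Automaton Σ' Δ) where
  open Automaton A

  record Config : Set where
    constructor config
    field
      state : Fin nstates
      pos   : Vec ℕ heads
      cell  : ℕ

  -- heads on the leftmost input symbol (position 1), memory at cell 0
  initConfig : Config
  initConfig = config q₀ (replicate heads 1) zero

  -- one deterministic step for input w and memory content μ : ℕ → Δ
  -- (nothing = the computation is stuck: a head left the tape ◁ w ▷)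
  step : List Σ' → (ℕ → Δ) → Config → Maybe Config
  step w μ (config q ps c) =
    readAll w ps >>= λ as →
    let (q' , ms , mm) = δ q as (μ c) in
    moveAll ms ps >>= λ ps' →
    just (config q' ps' (moveMem mm c))

  run : List Σ' → (ℕ → Δ) → ℕ → Maybe Config
  run w μ zero    = just initConfig
  run w μ (suc n) = run w μ n >>= step w μ

  AcceptsWith : List Σ' → (ℕ → Δ) → Set
  AcceptsWith w μ = ∃ λ n → ∃ λ c → run w μ n ≡ just c × accepting (Config.state c) ≡ true

InR : (s : ℕ) → (List (Fin s) → Set) → Set
InR s L = Σ ℕ λ d → Σ (Automaton (Fin s) (Fin d)) λ A →
  ∀ w → L w ⇔ (∃ λ (μ : ℕ → Fin d) → AcceptsWith A w μ)

-- k-sparse memory contents: Δ = Fin (suc d'), the symbol 0 is 'zero';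
-- at most k cells carry a symbol other than 0.
Sparse : {d' : ℕ} → ℕ → (ℕ → Fin (suc d')) → Set
Sparse k μ = ∃ λ (cs : List ℕ) → length cs ≤ k × (∀ n → μ n ≢ zero → n ∈ cs)

InRU : (k s : ℕ) → (List (Fin s) → Set) → Set
InRU k s L = Σ ℕ λ d' → Σ (Automaton (Fin s) (Fin (suc d'))) λ A →
  ∀ w → L w ⇔ (∃ λ (μ : ℕ → Fin (suc d')) → Sparse k μ × AcceptsWith A w μ)

module Submission where

-- A k-sparse guess can be replaced by an unrestricted one, because the
-- automaton can verify sparseness on the part of the memory it visits.
-- From A (memory alphabet Fin (1+d')) we build B whose guessed cells carry
-- a symbol of A and a stamp in {0,…,k}, claimed to be the number of
-- non-blank cells up to and including that cell.  B keeps in its state the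
-- count for the cells before its memory head (reset by '-', copied from the
-- stamp by '+'), checks stamp = counter + [symbol non-blank] at every step,
-- and enters a rejecting dead state on a mismatch; otherwise it acts as A.

open import Defs hiding (sym)
open import Data.Nat using (ℕ; zero; suc; _+_; _*_; _≤_; _<_; z≤n; s≤s; _≤?_; _<?_; _≟_)
open import Data.Nat.Properties
  using (≤-refl; ≤-trans; ≤-pred; <⇒≤; <⇒≢; ≤-<-trans; n<1+n; n≤1+n; m≤n+m; m<n⇒m<1+n;
         m≤n⇒m<n∨m≡n; +-mono-≤; +-monoʳ-≤; module ≤-Reasoning)
open import Data.Fin using (Fin; zero; suc; toℕ; combine; remQuot; quotient; remainder)
open import Data.Fin.Properties using (toℕ<n; remQuot-combine; 0≢1+n) renaming (_≟_ to _≟ᶠ_)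
open import Data.List using (List; []; _∷_; length; filter)
open import Data.List.Properties using (length-filter; filter-notAll)
open import Data.List.Membership.Propositional using (_∈_)
open import Data.List.Membership.Propositional.Properties using (∈-filter⁺)
open import Data.List.Relation.Unary.Any using (here; there)
import Data.List.Relation.Unary.Any as Any
open import Data.Vec using (Vec; replicate)
open import Data.Maybe using (Maybe; just; nothing; _>>=_)
import Data.Maybe as Maybe
open import Data.Maybe.Properties using (just-injective)
open import Data.Product using (∃; _×_; _,_; proj₁; proj₂)
open import Data.Sum using (_⊎_; inj₁; inj₂)
open import Data.Bool using (Bool; true; false)
open import Data.Unit using (⊤; tt)
open import Data.Empty using (⊥-elim)
open import Function using (_∘_)
open import Function.Bundles using (mk⇔; Equivalence)
open import Relation.Nullary using (Dec; yes; no; ¬?)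
open import Relation.Nullary.Decidable using (_×-dec_)
open import Relation.Binary.PropositionalEquality

weight : ∀ {d} → Fin (suc d) → ℕ
weight zero    = 0
weight (suc _) = 1

count : ∀ {d} → (ℕ → Fin (suc d)) → ℕ → ℕ
count a zero    = 0
count a (suc m) = weight (a m) + count a m

count-mono : ∀ {d} (a : ℕ → Fin (suc d)) {m n} → m ≤ n → count a m ≤ count a n
count-mono a {n = zero}  z≤n = z≤n
count-mono a {n = suc n} m≤1+n with m≤n⇒m<n∨m≡n m≤1+n
... | inj₂ refl  = ≤-refl
... | inj₁ m<1+n = ≤-trans (count-mono a (≤-pred m<1+n)) (m≤n+m (count a n) (weight (a n)))

count-dominated : ∀ {d} (a b : ℕ → Fin (suc d)) → (∀ m → weight (b m) ≤ weight (a m)) →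
                  ∀ m → count b m ≤ count a m
count-dominated a b below zero    = z≤n
count-dominated a b below (suc m) = +-mono-≤ (below m) (count-dominated a b below m)

count≤length : ∀ {d} (a : ℕ → Fin (suc d)) n (cs : List ℕ) →
               (∀ j → j < n → a j ≢ zero → j ∈ cs) → count a n ≤ length cs
count≤length a zero    cs covers = z≤n
count≤length a (suc n) cs covers = begin
    weight (a n) + count a n      ≤⟨ +-monoʳ-≤ (weight (a n)) (count≤length a n others covers′) ⟩
    weight (a n) + length others  ≤⟨ without-n ⟩
    length cs                     ∎
  where
  open ≤-Reasoning
  others : List ℕ
  others = filter (λ j → ¬? (j ≟ n)) cs

  covers′ : ∀ j → j < n → a j ≢ zero → j ∈ others
  covers′ j j<n nonblank =
    ∈-filter⁺ (λ j → ¬? (j ≟ n)) (covers j (m<n⇒m<1+n j<n) nonblank) (<⇒≢ j<n)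

  without-n : weight (a n) + length others ≤ length cs
  without-n with a n in an
  ... | zero  = length-filter (λ j → ¬? (j ≟ n)) cs
  ... | suc _ = filter-notAll (λ j → ¬? (j ≟ n)) cs
                  (Any.map (λ n≡j j≢n → j≢n (sym n≡j))
                    (covers n (n<1+n n) (λ blank → 0≢1+n (trans (sym blank) an))))

sparse-count : ∀ {d k} (μ : ℕ → Fin (suc d)) → Sparse k μ → ∀ m → count μ m ≤ k
sparse-count μ (cs , length≤k , covers) m =
  ≤-trans (count≤length μ m cs (λ j _ → covers j)) length≤k

support : ∀ {d} → (ℕ → Fin (suc d)) → ℕ → List ℕ
support a zero = []
support a (suc m) with a m
... | zero  = support a m
... | suc _ = m ∷ support a m

length-support : ∀ {d} (a : ℕ → Fin (suc d)) n → length (support a n) ≡ count a n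
length-support a zero = refl
length-support a (suc m) with a m
... | zero  = length-support a m
... | suc _ = cong suc (length-support a m)

∈-support : ∀ {d} (a : ℕ → Fin (suc d)) n j → j < n → a j ≢ zero → j ∈ support a n
∈-support a (suc m) j j<1+m nonblank with m≤n⇒m<n∨m≡n (≤-pred j<1+m) | a m in am
... | inj₁ j<m  | zero  = ∈-support a m j j<m nonblank
... | inj₁ j<m  | suc _ = there (∈-support a m j j<m nonblank)
... | inj₂ refl | zero  = ⊥-elim (nonblank am)
... | inj₂ refl | suc _ = here refl

keepIf : ∀ {d} {P : Set} → Dec P → Fin (suc d) → Fin (suc d)
keepIf (yes _) x = x
keepIf (no _)  x = zero

truncate : ∀ {d} (k n : ℕ) → (ℕ → Fin (suc d)) → ℕ → Fin (suc d)
truncate k n a m = keepIf (m <? n ×-dec count a (suc m) ≤? k) (a m)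

truncate-agrees : ∀ {d} k n (a : ℕ → Fin (suc d)) m → m < n → count a (suc m) ≤ k →
                  truncate k n a m ≡ a m
truncate-agrees k n a m m<n bounded with m <? n ×-dec count a (suc m) ≤? k
... | yes _ = refl
... | no  fails = ⊥-elim (fails (m<n , bounded))

truncate-nonblank : ∀ {d} k n (a : ℕ → Fin (suc d)) m → truncate k n a m ≢ zero →
                    m < n × count a (suc m) ≤ k
truncate-nonblank k n a m nonblank with m <? n ×-dec count a (suc m) ≤? k
... | yes holds = holds
... | no  _     = ⊥-elim (nonblank refl)

truncate-weight : ∀ {d} k n (a : ℕ → Fin (suc d)) m → weight (truncate k n a m) ≤ weight (a m)
truncate-weight k n a m with m <? n ×-dec count a (suc m) ≤? k
... | yes _ = ≤-refl
... | no  _ = z≤n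

-- Every prefix of the truncation has at most k non-blank cells: its last
-- non-blank cell m has at most count a (suc m) ≤ k of them up to it.
truncate-count : ∀ {d} k n (a : ℕ → Fin (suc d)) m → count (truncate k n a) m ≤ k
truncate-count k n a zero = z≤n
truncate-count k n a (suc m) with truncate k n a m ≟ᶠ zero
... | yes blank rewrite blank = truncate-count k n a m
... | no nonblank = ≤-trans (count-dominated a (truncate k n a) (truncate-weight k n a) (suc m))
                            (proj₂ (truncate-nonblank k n a m nonblank))

truncate-sparse : ∀ {d} k n (a : ℕ → Fin (suc d)) → Sparse k (truncate k n a)
truncate-sparse k n a =
  support (truncate k n a) n ,
  subst (_≤ k) (sym (length-support (truncate k n a) n)) (truncate-count k n a n) ,
  λ m nonblank → ∈-support (truncate k n a) n m (proj₁ (truncate-nonblank k n a m nonblank)) nonblank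

cap : (k m : ℕ) → Fin (suc k)
cap k       zero    = zero
cap zero    (suc m) = zero
cap (suc k) (suc m) = suc (cap k m)

toℕ-cap : ∀ k m → m ≤ k → toℕ (cap k m) ≡ m
toℕ-cap k       zero    _         = refl
toℕ-cap (suc k) (suc m) (s≤s m≤k) = cong suc (toℕ-cap k m m≤k)

cap-toℕ : ∀ k (x : Fin (suc k)) → cap k (toℕ x) ≡ x
cap-toℕ k       zero    = refl
cap-toℕ (suc k) (suc x) = cong suc (cap-toℕ k x)

step-local : ∀ {Σ' Δ} (X : Automaton Σ' Δ) w (μ ν : ℕ → Δ) q ps c → μ c ≡ ν c →
             step X w μ (config q ps c) ≡ step X w ν (config q ps c)
step-local X w μ ν q ps c same rewrite same = refl

moveMem-≤ : ∀ mm c → moveMem mm c ≤ suc c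
moveMem-≤ plus  c = ≤-refl
moveMem-≤ minus c = z≤n
moveMem-≤ mstay c = n≤1+n c

step-cell : ∀ {Σ' Δ} (X : Automaton Σ' Δ) w μ (cfg cfg′ : Config X) →
            step X w μ cfg ≡ just cfg′ → Config.cell cfg′ ≤ suc (Config.cell cfg)
step-cell X w μ (config q ps c) cfg′ stepped with readAll w ps
... | just as with moveAll (proj₁ (proj₂ (Automaton.δ X q as (μ c)))) ps
...   | just _ = subst (λ cfg → Config.cell cfg ≤ suc c) (just-injective stepped)
                       (moveMem-≤ (proj₂ (proj₂ (Automaton.δ X q as (μ c)))) c)

module Verifier {s d' : ℕ} (k : ℕ) (A : Automaton (Fin s) (Fin (suc d'))) where
  open Automaton A

  Counter : Set
  Counter = Fin (suc k)

  -- States of B: the dead state zero, and live states pairing a state of A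
  -- with the counter of non-blank cells before the memory head.
  nstatesB : ℕ
  nstatesB = suc (nstates * suc k)

  live : Fin nstates → Counter → Fin nstatesB
  live q p = suc (combine q p)

  nsymbolsB : ℕ
  nsymbolsB = suc d' * suc k

  symbolOf : Fin nsymbolsB → Fin (suc d')
  symbolOf = quotient (suc k)

  stampOf : Fin nsymbolsB → Counter
  stampOf = remainder {suc d'} (suc k)

  Output : Set
  Output = Fin nstatesB × Vec HeadMove heads × MemMove

  halt : Output
  halt = zero , replicate heads stay , mstay

  counterAfter : MemMove → (p st : Counter) → Counter
  counterAfter plus  p st = st
  counterAfter minus p st = zero
  counterAfter mstay p st = p

  advance : (p st : Counter) → Fin nstates × Vec HeadMove heads × MemMove → Output
  advance p st (q′ , ms , mm) = live q′ (counterAfter mm p st) , ms , mm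

  liveStep : Fin nstates × Counter → Vec (TapeSym (Fin s)) heads → Fin nsymbolsB → Output
  liveStep (q , p) as x with toℕ (stampOf x) ≟ weight (symbolOf x) + toℕ p
  ... | yes _ = advance p (stampOf x) (δ q as (symbolOf x))
  ... | no  _ = halt

  δB : Fin nstatesB → Vec (TapeSym (Fin s)) heads → Fin nsymbolsB → Output
  δB zero    as x = halt
  δB (suc e) as x = liveStep (remQuot (suc k) e) as x

  acceptingB : Fin nstatesB → Bool
  acceptingB zero    = false
  acceptingB (suc e) = accepting (quotient (suc k) e)

  B : Automaton (Fin s) (Fin nsymbolsB)
  B = record { heads = heads ; nstates = nstatesB ; δ = δB ; q₀ = live q₀ zero ; accepting = acceptingB }

  δB-live : ∀ q p as x → δB (live q p) as x ≡ liveStep (q , p) as x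
  δB-live q p as x = cong (λ qp → liveStep qp as x) (remQuot-combine q p)

  liveStep-passes : ∀ q p as x → toℕ (stampOf x) ≡ weight (symbolOf x) + toℕ p →
                    liveStep (q , p) as x ≡ advance p (stampOf x) (δ q as (symbolOf x))
  liveStep-passes q p as x passes with toℕ (stampOf x) ≟ weight (symbolOf x) + toℕ p
  ... | yes _    = refl
  ... | no fails = ⊥-elim (fails passes)

  liveStep-fails : ∀ q p as x → toℕ (stampOf x) ≢ weight (symbolOf x) + toℕ p →
                   liveStep (q , p) as x ≡ halt
  liveStep-fails q p as x fails with toℕ (stampOf x) ≟ weight (symbolOf x) + toℕ p
  ... | yes passes = ⊥-elim (fails passes)
  ... | no _       = refl

  encode : (ℕ → Fin (suc d')) → Config A → Config B
  encode a (config q ps c) = config (live q (cap k (count a c))) ps c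

  encode-accepting : ∀ a cA → acceptingB (Config.state (encode a cA)) ≡ accepting (Config.state cA)
  encode-accepting a (config q ps c) = cong (accepting ∘ proj₁) (remQuot-combine q (cap k (count a c)))

  check-meaning : ∀ (a : ℕ → Fin (suc d')) c x → symbolOf x ≡ a c → count a c ≤ k →
                  weight (symbolOf x) + toℕ (cap k (count a c)) ≡ count a (suc c)
  check-meaning a c x symbol≡ bounded = cong₂ _+_ (cong weight symbol≡) (toℕ-cap k (count a c) bounded)

  counterAfter-correct : ∀ (a : ℕ → Fin (suc d')) c st mm → toℕ st ≡ count a (suc c) →
                         counterAfter mm (cap k (count a c)) st ≡ cap k (count a (moveMem mm c))
  counterAfter-correct a c st plus  stamp≡ = trans (sym (cap-toℕ k st)) (cong (cap k) stamp≡)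
  counterAfter-correct a c st minus stamp≡ = refl
  counterAfter-correct a c st mstay stamp≡ = refl

  Halted : Maybe (Config B) → Set
  Halted nothing    = ⊤
  Halted (just cfg) = Config.state cfg ≡ zero

  halted-rejects : ∀ cB → Halted (just cB) → acceptingB (Config.state cB) ≢ true
  halted-rejects (config .zero ps c) refl ()

  step-to-dead : ∀ w μ′ q ps c → (∀ as → proj₁ (δB q as (μ′ c)) ≡ zero) →
                 Halted (step B w μ′ (config q ps c))
  step-to-dead w μ′ q ps c dies with readAll w ps
  ... | nothing = tt
  ... | just as with δB q as (μ′ c) | dies as
  ...   | (.zero , ms , mm) | refl with moveAll ms ps
  ...     | nothing = tt
  ...     | just _  = refl

  halted-stays : ∀ w μ′ mB → Halted mB → Halted (mB >>= step B w μ′)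
  halted-stays w μ′ nothing                  _    = tt
  halted-stays w μ′ (just (config .zero ps c)) refl = step-to-dead w μ′ zero ps c (λ _ → refl)

  step-simulates : ∀ w μ′ a q ps c → symbolOf (μ′ c) ≡ a c → count a c ≤ k →
                   toℕ (stampOf (μ′ c)) ≡ count a (suc c) →
                   step B w μ′ (encode a (config q ps c)) ≡ Maybe.map (encode a) (step A w a (config q ps c))
  step-simulates w μ′ a q ps c symbol≡ bounded stamp≡ with readAll w ps
  ... | nothing = refl
  ... | just as
    rewrite δB-live q (cap k (count a c)) as (μ′ c)
          | liveStep-passes q (cap k (count a c)) as (μ′ c)
              (trans stamp≡ (sym (check-meaning a c (μ′ c) symbol≡ bounded)))
          | symbol≡
    with δ q as (a c)
  ... | (q′ , ms , mm) with moveAll ms ps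
  ...   | nothing  = refl
  ...   | just ps′ = cong (λ p → just (config (live q′ p) ps′ (moveMem mm c)))
                          (counterAfter-correct a c (stampOf (μ′ c)) mm stamp≡)

  step-halts : ∀ w μ′ a q ps c → symbolOf (μ′ c) ≡ a c → count a c ≤ k →
               toℕ (stampOf (μ′ c)) ≢ count a (suc c) →
               Halted (step B w μ′ (encode a (config q ps c)))
  step-halts w μ′ a q ps c symbol≡ bounded wrong = step-to-dead w μ′ (live q p) ps c λ as →
    cong proj₁ (trans (δB-live q p as (μ′ c))
                      (liveStep-fails q p as (μ′ c)
                        (λ passes → wrong (trans passes (check-meaning a c (μ′ c) symbol≡ bounded)))))
    where
    p : Counter
    p = cap k (count a c)

  stamped : (ℕ → Fin (suc d')) → ℕ → Fin nsymbolsB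
  stamped μ m = combine (μ m) (cap k (count μ (suc m)))

  run-stamped : ∀ w μ → (∀ m → count μ m ≤ k) →
                ∀ t → run B w (stamped μ) t ≡ Maybe.map (encode μ) (run A w μ t)
  run-stamped w μ bounded zero = refl
  run-stamped w μ bounded (suc t) rewrite run-stamped w μ bounded t with run A w μ t
  ... | nothing = refl
  ... | just (config q ps c) =
    step-simulates w (stamped μ) μ q ps c
      (cong proj₁ (remQuot-combine (μ c) stamp))
      (bounded c)
      (trans (cong (toℕ ∘ proj₂) (remQuot-combine (μ c) stamp)) (toℕ-cap k _ (bounded (suc c))))
    where
    stamp : Counter
    stamp = cap k (count μ (suc c))

  complete : ∀ w → (∃ λ μ → Sparse k μ × AcceptsWith A w μ) → ∃ λ μ′ → AcceptsWith B w μ′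
  complete w (μ , sparse , t , cA , ranA , acc) =
    stamped μ , t , encode μ cA ,
    trans (run-stamped w μ (sparse-count μ sparse) t) (cong (Maybe.map (encode μ)) ranA) ,
    trans (encode-accepting μ cA) acc

  -- Soundness: a run of B for n steps on a guess μ′ is tracked by a run of A
  -- on any content ν that agrees with the symbols a of μ′ on those cells
  -- below n that have at most k non-blank cells up to them.
  module Soundness (w : List (Fin s)) (μ′ : ℕ → Fin nsymbolsB) (n : ℕ) (ν : ℕ → Fin (suc d'))
                   (agrees : ∀ c → c < n → count (symbolOf ∘ μ′) (suc c) ≤ k →
                             ν c ≡ symbolOf (μ′ c)) where
    a : ℕ → Fin (suc d')
    a = symbolOf ∘ μ′

    Tracks : Maybe (Config A) → Maybe (Config B) → ℕ → Set
    Tracks mA mB t = ∃ λ cA → mA ≡ just cA × mB ≡ just (encode a cA) ×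
                       count a (Config.cell cA) ≤ k × Config.cell cA ≤ t

    -- If B's step encodes A's step from a tracked configuration whose cell passed
    -- the check, tracking continues, since the memory head moves by at most one.
    keeps-tracking : ∀ t cA → Config.cell cA ≤ t → count a (suc (Config.cell cA)) ≤ k →
                     step B w μ′ (encode a cA) ≡ Maybe.map (encode a) (step A w ν cA) →
                     Halted (step B w μ′ (encode a cA)) ⊎
                     Tracks (step A w ν cA) (step B w μ′ (encode a cA)) (suc t)
    keeps-tracking t cA c≤t bounded simulation with step A w ν cA in stepped
    ... | nothing  = inj₁ (subst Halted (sym simulation) tt)
    ... | just cA′ = inj₂ (cA′ , refl , simulation ,
                           ≤-trans (count-mono a moved) bounded , ≤-trans moved (s≤s c≤t))
      where
      moved : Config.cell cA′ ≤ suc (Config.cell cA)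
      moved = step-cell A w ν cA cA′ stepped

    -- One step: a wrong stamp halts B; a correct one bounds count a (suc c) by k,
    -- so ν agrees with a at c and B simulates A on ν.
    tracks-step : ∀ t cA → Config.cell cA ≤ t → t < n → count a (Config.cell cA) ≤ k →
                  Halted (step B w μ′ (encode a cA)) ⊎
                  Tracks (step A w ν cA) (step B w μ′ (encode a cA)) (suc t)
    tracks-step t (config q ps c) c≤t t<n bounded with toℕ (stampOf (μ′ c)) ≟ count a (suc c)
    ... | no wrong    = inj₁ (step-halts w μ′ a q ps c refl bounded wrong)
    ... | yes correct = keeps-tracking t (config q ps c) c≤t bounded′
        (trans (step-simulates w μ′ a q ps c refl bounded correct)
               (cong (Maybe.map (encode a))
                     (step-local A w a ν q ps c (sym (agrees c (≤-<-trans c≤t t<n) bounded′)))))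
      where
      bounded′ : count a (suc c) ≤ k
      bounded′ = subst (_≤ k) correct (≤-pred (toℕ<n (stampOf (μ′ c))))

    tracks : ∀ t → t ≤ n → Halted (run B w μ′ t) ⊎ Tracks (run A w ν t) (run B w μ′ t) t
    tracks zero    _   = inj₂ (initConfig A , refl , refl , z≤n , z≤n)
    tracks (suc t) t<n with tracks t (<⇒≤ t<n)
    ... | inj₁ halted = inj₁ (halted-stays w μ′ (run B w μ′ t) halted)
    ... | inj₂ (cA , ranA , ranB , bounded , c≤t) rewrite ranA | ranB =
      tracks-step t cA c≤t t<n bounded

    accepted : ∀ cB → run B w μ′ n ≡ just cB → acceptingB (Config.state cB) ≡ true → AcceptsWith A w ν
    accepted cB ranB acc with tracks n ≤-refl
    ... | inj₁ halted = ⊥-elim (halted-rejects cB (subst Halted ranB halted) acc)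
    ... | inj₂ (cA , ranA , ranB′ , _) =
      n , cA , ranA ,
      trans (sym (encode-accepting a cA))
            (subst (λ cB → acceptingB (Config.state cB) ≡ true) (just-injective (trans (sym ranB) ranB′)) acc)

  sound : ∀ w → (∃ λ μ′ → AcceptsWith B w μ′) → ∃ λ μ → Sparse k μ × AcceptsWith A w μ
  sound w (μ′ , n , cB , ranB , acc) =
    truncate k n a , truncate-sparse k n a ,
    Soundness.accepted w μ′ n (truncate k n a) (truncate-agrees k n a) cB ranB acc
    where
    a : ℕ → Fin (suc d')
    a = symbolOf ∘ μ′

-- B accepts with an unrestricted guess exactly the words A accepts with a
-- k-sparse guess (the construction works for k = 0 as well).
lemma3 : (k : ℕ) → 1 ≤ k → (s : ℕ) → (L : List (Fin s) → Set) →
    InRU k s L → InR s L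
lemma3 k _ s L (d' , A , L⇔) =
  nsymbolsB , B , λ w → mk⇔ (complete w ∘ Equivalence.to (L⇔ w)) (Equivalence.from (L⇔ w) ∘ sound w)
  where open Verifier k A
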